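{- For every positive rational number $x\in\mathbb{Q}_{>0}$, whose even-length continued fraction expansion is $[a_0;a_1,\dots,a_{2\ell-1}]$, the cardinality statistics over the set $\mathcal{J}(x)$ of order ideals of the fence poset $\mathcal{F}(x)$ satisfies \[ \left(\begin{array}{r} \sum_{I\in \mathcal{J}^\bullet(x)} q^{|I|}\\ \sum_{I\in \mathcal{J}^\circ(x)} q^{|I|} \end{array}\right) = \left(\begin{smallmatrix} 1 & 0 \\ 0 & q \end{smallmatrix}\right)^{ -1} R_q^{a_0}L_q^{a_1}\cdots R_q^{a_{2\ell-2}}L_q^{a_{2\ell-1}} \left(\begin{smallmatrix} 1 \\ 0 \end{smallmatrix}\right). \]
   Context: Here $q$ is an indeterminate, $L_q=\left(\begin{smallmatrix} q & 0\\ q & 1\end{smallmatrix}\right)$, $R_q=\left(\begin{smallmatrix} q & 1\\ 0 & 1\end{smallmatrix}\right)$, and the even-length expansion has $a_0\ge0$, $a_i\ge1$ for $i\ge1$. Let $W(x)=\mathtt{1}^{a_0}\mathtt{0}^{a_1}\cdots\mathtt{1}^{a_{2\ell-2}}\mathtt{0}^{a_{2\ell-1}-1}\in\{\mathtt{0},\mathtt{1}\}^*$. For a word $w=w_1\cdots w_n$, the fence poset $F(w)$ has elements $y_0,\dots,y_n$ with covering relations $y_{i-1}\lhd y_i$ if $w_i=\mathtt{0}$ and $y_{i-1}\rhd y_i$ if $w_i=\mathtt{1}$. Set $\mathcal{F}(x)=F(W(x))$, and $\mathcal{J}(x)$ the set of lower order ideals of $\mathcal{F}(x)$, partitioned into $\mathcal{J}^\bullet(x)=\{I\mid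 y_0\in I\}$ and $\mathcal{J}^\circ(x)=\{I\mid y_0\notin I\}$; $|I|$ is the cardinality of $I$. -}

module Defs where

open import Data.Nat using (ℕ; zero; suc; _+_; _*_; _∸_; _≡ᵇ_; _≤_)
open import Data.Bool using (Bool; true; false; _∧_; _∨_; not; if_then_else_)
open import Data.List using (List; []; _∷_; _++_; replicate; length; map; filter; concatMap; sum; lookup)
open import Data.Product using (_×_; _,_; proj₁; proj₂)
open import Relation.Binary.PropositionalEquality using (_≡_)
open import Data.Integer as ℤ using (ℤ; +_)
open import Data.Rational using (ℚ; ↥_; ↧_)
open import Data.Fin using (Fin)
import Data.Fin as Fin

-- Polynomials in q with ℕ coefficients, as coefficient functions
-- (p n = coefficient of q^n).

Poly : Set
Poly = ℕ → ℕ

0ₚ 1ₚ qₚ : Poly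
0ₚ _ = 0
1ₚ zero = 1
1ₚ (suc _) = 0
qₚ (suc zero) = 1
qₚ _ = 0

infixl 6 _+ₚ_
infixl 7 _*ₚ_

_+ₚ_ : Poly → Poly → Poly
(f +ₚ g) n = f n + g n

convAux : Poly → Poly → ℕ → ℕ → ℕ
convAux f g n zero = f 0 * g n
convAux f g n (suc k) = f (suc k) * g (n ∸ suc k) + convAux f g n k

_*ₚ_ : Poly → Poly → Poly
(f *ₚ g) n = convAux f g n n

record Mat : Set where
  constructor mat
  field
    m11 m12 m21 m22 : Poly

record Vec2 : Set where
  constructor vec2
  field
    v1 v2 : Poly

open Mat
open Vec2

_⊗_ : Mat → Mat → Mat
A ⊗ B = mat (m11 A *ₚ m11 B +ₚ m12 A *ₚ m21 B)
            (m11 A *ₚ m12 B +ₚ m12 A *ₚ m22 B)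
            (m21 A *ₚ m11 B +ₚ m22 A *ₚ m21 B)
            (m21 A *ₚ m12 B +ₚ m22 A *ₚ m22 B)

_·_ : Mat → Vec2 → Vec2
A · v = vec2 (m11 A *ₚ v1 v +ₚ m12 A *ₚ v2 v)
             (m21 A *ₚ v1 v +ₚ m22 A *ₚ v2 v)

Id : Mat
Id = mat 1ₚ 0ₚ 0ₚ 1ₚ

_^ₘ_ : Mat → ℕ → Mat
A ^ₘ zero = Id
A ^ₘ suc n = A ⊗ (A ^ₘ n)

Lq Rq : Mat
Lq = mat qₚ 0ₚ qₚ 1ₚ
Rq = mat qₚ 1ₚ 0ₚ 1ₚ

cfMat : List ℕ → Mat
cfMat (a ∷ b ∷ rest) = (Rq ^ₘ a) ⊗ ((Lq ^ₘ b) ⊗ cfMat rest)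
cfMat _ = Id

cfFrac : List ℕ → ℕ × ℕ
cfFrac [] = 1 , 0
cfFrac (a ∷ rest) with cfFrac rest
... | p , q = a * p + q , p

-- the list a is a (valid) continued fraction expansion of x :
-- a_i ≥ 1 for i ≥ 1 (a_0 ≥ 0 is automatic for ℕ), and its value is x
AllPos : List ℕ → Set
AllPos [] = Data.Unit.⊤ where import Data.Unit
AllPos (a ∷ as) = (1 ≤ a) × AllPos as

IsCF : List ℕ → ℚ → Set
IsCF [] x = Data.Empty.⊥ where import Data.Empty
IsCF (a0 ∷ as) x = AllPos as ×
  ((↥ x) ℤ.* (+ proj₂ (cfFrac (a0 ∷ as))) ≡ (+ proj₁ (cfFrac (a0 ∷ as))) ℤ.* (↧ x))

data EvenPos : List ℕ → Set where
  two  : ∀ a b → EvenPos (a ∷ b ∷ [])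
  more : ∀ a b {rest} → EvenPos rest → EvenPos (a ∷ b ∷ rest)

-- The word W(x) = 1^{a0} 0^{a1} ... 1^{a_{2l-2}} 0^{a_{2l-1} - 1}
-- letters: true = 𝟷, false = 𝟶

W : List ℕ → List Bool
W (a ∷ b ∷ []) = replicate a true ++ replicate (b ∸ 1) false
W (a ∷ b ∷ rest) = replicate a true ++ replicate b false ++ W rest
W _ = []

-- Fence poset F(w) on y_0 .. y_n (n = length w).  A subset of
-- {y_0..y_n} is a list of booleans of length n+1 (membership).  CONVENTION: the literal
-- reading "w_i = 0 : y_{i-1} below y_i" makes the theorem false
-- (e.g. x = 2 = [1;1]); the matrix identity holds when w_i = 0 means
-- y_i is covered by y_{i-1} and w_i = 1 means y_{i-1} is covered by y_i.
-- (Equivalently: the paper's ⊲ read as "covers".)  We use the latter.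
-- Lower order ideal = closed downward under all covering relations
-- (equivalently under the partial order, its reflexive-transitive closure).

_⇒ᵇ_ : Bool → Bool → Bool
x ⇒ᵇ y = not x ∨ y

isIdeal : List Bool → List Bool → Bool
isIdeal (false ∷ w) (x ∷ y ∷ s) = (x ⇒ᵇ y) ∧ isIdeal w (y ∷ s)
isIdeal (true ∷ w) (x ∷ y ∷ s) = (y ⇒ᵇ x) ∧ isIdeal w (y ∷ s)
isIdeal [] (_ ∷ []) = true
isIdeal _ _ = false

subsets : ℕ → List (List Bool)
subsets zero = [] ∷ []
subsets (suc m) = concatMap (λ s → (true ∷ s) ∷ (false ∷ s) ∷ []) (subsets m)

card : List Bool → ℕ
card [] = 0
card (true ∷ s) = suc (card s)
card (false ∷ s) = card s

containsY0 : List Bool → Bool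
containsY0 (b ∷ _) = b
containsY0 [] = false

ideals : List Bool → List (List Bool)
ideals w = filter (λ s → Data.Bool.T? (isIdeal w s)) (subsets (suc (length w)))
  where import Data.Bool

count : (List Bool → Bool) → List (List Bool) → ℕ
count P [] = 0
count P (s ∷ ss) = (if P s then 1 else 0) + count P ss

genBullet genCirc : List Bool → Poly
genBullet w k = count (λ I → containsY0 I ∧ (card I ≡ᵇ k)) (ideals w)
genCirc w k = count (λ I → not (containsY0 I) ∧ (card I ≡ᵇ k)) (ideals w)

{-# OPTIONS --safe #-}
-- For a word w put u(w) = (Σ_{y₀ ∈ I} q^|I| , q · Σ_{y₀ ∉ I} q^|I|), summing over the
-- ideals I of F(w).  Prepending a letter adds a new element y₀, covered by y₁ for 𝟷 and
-- covering y₁ for 𝟶.  Splitting the ideals according to whether they contain y₁ gives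
-- u(𝟷w) = R_q u(w) and u(𝟶w) = L_q u(w), while the one-point fence has u = (q , q) = L_q (1 , 0);
-- this last factor L_q is why W(x) ends with 𝟶^(a_{2ℓ-1} - 1).  Reading W(x) from the right
-- therefore builds up the matrix product, once one knows that polynomial multiplication
-- (convolution of coefficient functions) is associative, so that matrix products act on vectors.
module Submission where

open import Defs
open import Data.Nat using (ℕ; suc)
open import Data.List using (List)
open import Data.Product using (_×_)
open import Relation.Binary.PropositionalEquality using (_≡_)
open import Data.Rational using (ℚ; 0ℚ; _<_)

open import Data.Nat using (zero; _+_; _*_; _∸_; _≡ᵇ_)
open import Data.Nat.Properties
  using (+-assoc; +-comm; +-identityʳ; *-identityˡ; *-assoc; *-distribˡ-+; *-distribʳ-+; +-commutativeSemigroup)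
open import Algebra.Properties.CommutativeSemigroup +-commutativeSemigroup using (interchange; x∙yz≈y∙xz)
open import Data.Bool using (Bool; true; false; _∧_; not; if_then_else_; T?)
open import Data.Bool.Properties using (∧-zeroʳ)
open import Data.List using ([]; _∷_; _++_; replicate; length; filter; concatMap)
open import Data.List.Properties using (++-identityʳ)
open import Data.Product using (_,_; proj₁; proj₂)
open import Relation.Binary.Bundles using (Setoid)
open import Relation.Binary.Structures using (IsEquivalence)
open import Relation.Binary.PropositionalEquality using (refl; sym; trans; cong; cong₂; _≗_; module ≡-Reasoning)
import Relation.Binary.Reasoning.Setoid as SetoidReasoning
open Mat
open Vec2

shift : Poly → Poly
shift p zero = 0
shift p (suc n) = p n

tailₚ : Poly → Poly
tailₚ p n = p (suc n)

scale : ℕ → Poly → Poly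
scale c p n = c * p n

shift-cong : ∀ {f g} → f ≗ g → shift f ≗ shift g
shift-cong f≗g zero = refl
shift-cong f≗g (suc n) = f≗g n

shift-+ₚ : ∀ f g → shift (f +ₚ g) ≗ shift f +ₚ shift g
shift-+ₚ f g zero = refl
shift-+ₚ f g (suc n) = refl

*ₚ-cong : ∀ {f f′ g g′} → f ≗ f′ → g ≗ g′ → f *ₚ g ≗ f′ *ₚ g′
*ₚ-cong {f} {f′} {g} {g′} f≗f′ g≗g′ n = go n
  where
  go : ∀ k → convAux f g n k ≡ convAux f′ g′ n k
  go zero = cong₂ _*_ (f≗f′ 0) (g≗g′ n)
  go (suc k) = cong₂ _+_ (cong₂ _*_ (f≗f′ (suc k)) (g≗g′ (n ∸ suc k))) (go k)

*ₚ-distribʳ-+ₚ : ∀ f g h → (f +ₚ g) *ₚ h ≗ f *ₚ h +ₚ g *ₚ h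
*ₚ-distribʳ-+ₚ f g h n = go n
  where
  go : ∀ k → convAux (f +ₚ g) h n k ≡ convAux f h n k + convAux g h n k
  go zero = *-distribʳ-+ (h n) (f 0) (g 0)
  go (suc k) = trans (cong₂ _+_ (*-distribʳ-+ (h (n ∸ suc k)) (f (suc k)) (g (suc k))) (go k))
                     (interchange (f (suc k) * h (n ∸ suc k)) _ (convAux f h n k) _)

*ₚ-distribˡ-+ₚ : ∀ f g h → f *ₚ (g +ₚ h) ≗ f *ₚ g +ₚ f *ₚ h
*ₚ-distribˡ-+ₚ f g h n = go n
  where
  go : ∀ k → convAux f (g +ₚ h) n k ≡ convAux f g n k + convAux f h n k
  go zero = *-distribˡ-+ (f 0) (g n) (h n)
  go (suc k) = trans (cong₂ _+_ (*-distribˡ-+ (f (suc k)) (g (n ∸ suc k)) (h (n ∸ suc k))) (go k))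
                     (interchange (f (suc k) * g (n ∸ suc k)) _ (convAux f g n k) _)

scale-*ₚ : ∀ c f g → scale c f *ₚ g ≗ scale c (f *ₚ g)
scale-*ₚ c f g n = go n
  where
  go : ∀ k → convAux (scale c f) g n k ≡ c * convAux f g n k
  go zero = *-assoc c (f 0) (g n)
  go (suc k) = trans (cong₂ _+_ (*-assoc c _ _) (go k)) (sym (*-distribˡ-+ c _ _))

-- f = f 0 + q · tailₚ f
*ₚ-unfoldˡ : ∀ f g → f *ₚ g ≗ scale (f 0) g +ₚ shift (tailₚ f *ₚ g)
*ₚ-unfoldˡ f g zero = sym (+-identityʳ _)
*ₚ-unfoldˡ f g (suc n) = go n
  where
  go : ∀ k → convAux f g (suc n) (suc k) ≡ f 0 * g (suc n) + convAux (tailₚ f) g n k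
  go zero = +-comm (f 1 * g n) (f 0 * g (suc n))
  go (suc k) = trans (cong (f (suc (suc k)) * g (n ∸ suc k) +_) (go k))
                     (x∙yz≈y∙xz (f (suc (suc k)) * g (n ∸ suc k)) (f 0 * g (suc n)) _)

shift-*ₚ : ∀ f g → shift f *ₚ g ≗ shift (f *ₚ g)
shift-*ₚ f g = *ₚ-unfoldˡ (shift f) g

*ₚ-assoc : ∀ f g h → (f *ₚ g) *ₚ h ≗ f *ₚ (g *ₚ h)
*ₚ-assoc f g h n = begin
  ((f *ₚ g) *ₚ h) n                                      ≡⟨ *ₚ-cong (*ₚ-unfoldˡ f g) (λ _ → refl) n ⟩
  ((scale (f 0) g +ₚ shift (tailₚ f *ₚ g)) *ₚ h) n         ≡⟨ *ₚ-distribʳ-+ₚ _ _ h n ⟩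
  (scale (f 0) g *ₚ h) n + (shift (tailₚ f *ₚ g) *ₚ h) n   ≡⟨ cong₂ _+_ (scale-*ₚ (f 0) g h n) (shift-*ₚ _ h n) ⟩
  f 0 * (g *ₚ h) n + shift ((tailₚ f *ₚ g) *ₚ h) n       ≡⟨ cong (f 0 * (g *ₚ h) n +_) (shifted n) ⟩
  f 0 * (g *ₚ h) n + shift (tailₚ f *ₚ (g *ₚ h)) n       ≡⟨ sym (*ₚ-unfoldˡ f (g *ₚ h) n) ⟩
  (f *ₚ (g *ₚ h)) n                                      ∎
  where
  open ≡-Reasoning
  shifted : ∀ m → shift ((tailₚ f *ₚ g) *ₚ h) m ≡ shift (tailₚ f *ₚ (g *ₚ h)) m
  shifted zero = refl
  shifted (suc m) = *ₚ-assoc (tailₚ f) g h m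

*ₚ-zeroˡ : ∀ f → 0ₚ *ₚ f ≗ 0ₚ
*ₚ-zeroˡ f n = go n
  where
  go : ∀ k → convAux 0ₚ f n k ≡ 0
  go zero = refl
  go (suc k) = go k

*ₚ-identityˡ : ∀ f → 1ₚ *ₚ f ≗ f
*ₚ-identityˡ f n = begin
  (1ₚ *ₚ f) n                        ≡⟨ *ₚ-unfoldˡ 1ₚ f n ⟩
  1 * f n + shift (tailₚ 1ₚ *ₚ f) n  ≡⟨ cong (1 * f n +_) (vanish n) ⟩
  1 * f n + 0                        ≡⟨ +-identityʳ _ ⟩
  1 * f n                            ≡⟨ *-identityˡ (f n) ⟩
  f n                                ∎
  where
  open ≡-Reasoning
  vanish : ∀ m → shift (tailₚ 1ₚ *ₚ f) m ≡ 0
  vanish zero = refl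
  vanish (suc m) = *ₚ-zeroˡ f m

qₚ-*ₚ : ∀ f → qₚ *ₚ f ≗ shift f
qₚ-*ₚ f n = trans (*ₚ-unfoldˡ qₚ f n) (shift-cong (λ m → trans (*ₚ-cong tailₚ-qₚ (λ _ → refl) m) (*ₚ-identityˡ f m)) n)
  where
  tailₚ-qₚ : tailₚ qₚ ≗ 1ₚ
  tailₚ-qₚ zero = refl
  tailₚ-qₚ (suc _) = refl

infix 4 _≈_
_≈_ : Vec2 → Vec2 → Set
u ≈ v = (v1 u ≗ v1 v) × (v2 u ≗ v2 v)

≈-isEquivalence : IsEquivalence _≈_
≈-isEquivalence = record
  { refl  = (λ _ → refl) , (λ _ → refl)
  ; sym   = λ (p , p′) → (λ n → sym (p n)) , (λ n → sym (p′ n))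
  ; trans = λ (p , p′) (r , r′) → (λ n → trans (p n) (r n)) , (λ n → trans (p′ n) (r′ n))
  }

Vec2-setoid : Setoid _ _
Vec2-setoid = record { isEquivalence = ≈-isEquivalence }

open Setoid Vec2-setoid using () renaming (sym to ≈-sym)

module ≈-Reasoning = SetoidReasoning Vec2-setoid

·-congˡ : ∀ A {u v} → u ≈ v → A · u ≈ A · v
·-congˡ A (p , p′) = entry (m11 A) (m12 A) , entry (m21 A) (m22 A)
  where
  entry : ∀ a b → a *ₚ _ +ₚ b *ₚ _ ≗ a *ₚ _ +ₚ b *ₚ _
  entry a b n = cong₂ _+_ (*ₚ-cong (λ _ → refl) p n) (*ₚ-cong (λ _ → refl) p′ n)

row-·-assoc : ∀ a c b e d f x y →
  (a *ₚ b +ₚ c *ₚ d) *ₚ x +ₚ (a *ₚ e +ₚ c *ₚ f) *ₚ y ≗ a *ₚ (b *ₚ x +ₚ e *ₚ y) +ₚ c *ₚ (d *ₚ x +ₚ f *ₚ y)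
row-·-assoc a c b e d f x y n = begin
  ((a *ₚ b +ₚ c *ₚ d) *ₚ x) n + ((a *ₚ e +ₚ c *ₚ f) *ₚ y) n
    ≡⟨ cong₂ _+_ (*ₚ-distribʳ-+ₚ (a *ₚ b) (c *ₚ d) x n) (*ₚ-distribʳ-+ₚ (a *ₚ e) (c *ₚ f) y n) ⟩
  (((a *ₚ b) *ₚ x) n + ((c *ₚ d) *ₚ x) n) + (((a *ₚ e) *ₚ y) n + ((c *ₚ f) *ₚ y) n)
    ≡⟨ cong₂ _+_ (cong₂ _+_ (*ₚ-assoc a b x n) (*ₚ-assoc c d x n)) (cong₂ _+_ (*ₚ-assoc a e y n) (*ₚ-assoc c f y n)) ⟩
  ((a *ₚ (b *ₚ x)) n + (c *ₚ (d *ₚ x)) n) + ((a *ₚ (e *ₚ y)) n + (c *ₚ (f *ₚ y)) n)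
    ≡⟨ interchange ((a *ₚ (b *ₚ x)) n) ((c *ₚ (d *ₚ x)) n) ((a *ₚ (e *ₚ y)) n) ((c *ₚ (f *ₚ y)) n) ⟩
  ((a *ₚ (b *ₚ x)) n + (a *ₚ (e *ₚ y)) n) + ((c *ₚ (d *ₚ x)) n + (c *ₚ (f *ₚ y)) n)
    ≡⟨ sym (cong₂ _+_ (*ₚ-distribˡ-+ₚ a (b *ₚ x) (e *ₚ y) n) (*ₚ-distribˡ-+ₚ c (d *ₚ x) (f *ₚ y) n)) ⟩
  (a *ₚ (b *ₚ x +ₚ e *ₚ y)) n + (c *ₚ (d *ₚ x +ₚ f *ₚ y)) n
    ∎
  where open ≡-Reasoning

⊗-· : ∀ A B v → (A ⊗ B) · v ≈ A · (B · v)
⊗-· A B v = row-·-assoc (m11 A) (m12 A) (m11 B) (m12 B) (m21 B) (m22 B) (v1 v) (v2 v)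
          , row-·-assoc (m21 A) (m22 A) (m11 B) (m12 B) (m21 B) (m22 B) (v1 v) (v2 v)

Id-· : ∀ v → Id · v ≈ v
Id-· v = (λ n → trans (cong₂ _+_ (*ₚ-identityˡ (v1 v) n) (*ₚ-zeroˡ (v2 v) n)) (+-identityʳ _))
       , (λ n → cong₂ _+_ (*ₚ-zeroˡ (v1 v) n) (*ₚ-identityˡ (v2 v) n))

Rq-· : ∀ x y → Rq · vec2 x y ≈ vec2 (shift x +ₚ y) y
Rq-· x y = (λ n → cong₂ _+_ (qₚ-*ₚ x n) (*ₚ-identityˡ y n))
         , (λ n → cong₂ _+_ (*ₚ-zeroˡ x n) (*ₚ-identityˡ y n))

Lq-· : ∀ x y → Lq · vec2 x y ≈ vec2 (shift x) (shift x +ₚ y)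
Lq-· x y = (λ n → trans (cong₂ _+_ (qₚ-*ₚ x n) (*ₚ-zeroˡ y n)) (+-identityʳ _))
         , (λ n → cong₂ _+_ (qₚ-*ₚ x n) (*ₚ-identityˡ y n))

^ₘ-suc-· : ∀ A n v → (A ^ₘ suc n) · v ≈ (A ^ₘ n) · (A · v)
^ₘ-suc-· A zero v = begin
  (A ⊗ Id) · v   ≈⟨ ⊗-· A Id v ⟩
  A · (Id · v)   ≈⟨ ·-congˡ A (Id-· v) ⟩
  A · v          ≈⟨ Id-· (A · v) ⟨
  Id · (A · v)   ∎
  where open ≈-Reasoning
^ₘ-suc-· A (suc n) v = begin
  (A ⊗ (A ^ₘ suc n)) · v     ≈⟨ ⊗-· A (A ^ₘ suc n) v ⟩
  A · ((A ^ₘ suc n) · v)     ≈⟨ ·-congˡ A (^ₘ-suc-· A n v) ⟩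
  A · ((A ^ₘ n) · (A · v))   ≈⟨ ⊗-· A (A ^ₘ n) (A · v) ⟨
  (A ^ₘ suc n) · (A · v)     ∎
  where open ≈-Reasoning

count-cong : ∀ {P Q : List Bool → Bool} → (∀ s → P s ≡ Q s) → ∀ L → count P L ≡ count Q L
count-cong P≡Q [] = refl
count-cong P≡Q (s ∷ L) = cong₂ _+_ (cong (λ b → if b then 1 else 0) (P≡Q s)) (count-cong P≡Q L)

count-false : ∀ L → count (λ _ → false) L ≡ 0
count-false [] = refl
count-false (_ ∷ L) = count-false L

count-∧-false : ∀ (P : List Bool → Bool) L → count (λ s → P s ∧ false) L ≡ 0
count-∧-false P L = trans (count-cong {λ s → P s ∧ false} (λ s → ∧-zeroʳ (P s)) L) (count-false L)

count-filter : ∀ (Q P : List Bool → Bool) L → count P (filter (λ s → T? (Q s)) L) ≡ count (λ s → Q s ∧ P s) L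
count-filter Q P [] = refl
count-filter Q P (s ∷ L) with Q s
... | true  = cong ((if P s then 1 else 0) +_) (count-filter Q P L)
... | false = count-filter Q P L

count-subsets-suc : ∀ P m →
  count P (subsets (suc m)) ≡ count (λ s → P (true ∷ s)) (subsets m) + count (λ s → P (false ∷ s)) (subsets m)
count-subsets-suc P m = go (subsets m)
  where
  go : ∀ L → count P (concatMap (λ s → (true ∷ s) ∷ (false ∷ s) ∷ []) L)
           ≡ count (λ s → P (true ∷ s)) L + count (λ s → P (false ∷ s)) L
  go [] = refl
  go (s ∷ L) = trans (cong (λ r → t + (f + r)) (go L))
                     (trans (sym (+-assoc t f _)) (interchange t f (count (λ s → P (true ∷ s)) L) _))
    where
    t f : ℕ
    t = if P (true ∷ s) then 1 else 0
    f = if P (false ∷ s) then 1 else 0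

idealPoly : List Bool → Bool → Poly
idealPoly []          true  = qₚ
idealPoly []          false = 1ₚ
idealPoly (true ∷ w)  true  = shift (idealPoly w true +ₚ idealPoly w false)
idealPoly (true ∷ w)  false = idealPoly w false
idealPoly (false ∷ w) true  = shift (idealPoly w true)
idealPoly (false ∷ w) false = idealPoly w true +ₚ idealPoly w false

countIdeals : List Bool → Bool → Poly
countIdeals w y k = count (λ s → isIdeal w (y ∷ s) ∧ (card (y ∷ s) ≡ᵇ k)) (subsets (length w))

countIdeals≗idealPoly : ∀ w y → countIdeals w y ≗ idealPoly w y
countIdeals≗idealPoly []          true  zero          = refl
countIdeals≗idealPoly []          true  (suc zero)    = refl
countIdeals≗idealPoly []          true  (suc (suc k)) = refl
countIdeals≗idealPoly []          false zero          = refl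
countIdeals≗idealPoly []          false (suc k)       = refl
countIdeals≗idealPoly (true ∷ w)  true  zero          = trans (count-subsets-suc _ (length w))
  (cong₂ _+_ (count-∧-false (λ s → isIdeal w (true ∷ s)) (subsets (length w))) (count-∧-false (λ s → isIdeal w (false ∷ s)) (subsets (length w))))
countIdeals≗idealPoly (true ∷ w)  true  (suc k)       = trans (count-subsets-suc _ (length w))
  (cong₂ _+_ (countIdeals≗idealPoly w true k) (countIdeals≗idealPoly w false k))
countIdeals≗idealPoly (true ∷ w)  false k             = trans (count-subsets-suc _ (length w))
  (cong₂ _+_ (count-false (subsets (length w))) (countIdeals≗idealPoly w false k))
countIdeals≗idealPoly (false ∷ w) true  zero          = trans (count-subsets-suc _ (length w))
  (cong₂ _+_ (count-∧-false (λ s → isIdeal w (true ∷ s)) (subsets (length w))) (count-false (subsets (length w))))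
countIdeals≗idealPoly (false ∷ w) true  (suc k)       = trans (count-subsets-suc _ (length w))
  (trans (cong₂ _+_ (countIdeals≗idealPoly w true k) (count-false (subsets (length w)))) (+-identityʳ _))
countIdeals≗idealPoly (false ∷ w) false k             = trans (count-subsets-suc _ (length w))
  (cong₂ _+_ (countIdeals≗idealPoly w true k) (countIdeals≗idealPoly w false k))

genBullet≗idealPoly : ∀ w → genBullet w ≗ idealPoly w true
genBullet≗idealPoly w k = begin
  genBullet w k
    ≡⟨ count-filter (isIdeal w) _ (subsets (suc (length w))) ⟩
  count (λ s → isIdeal w s ∧ (containsY0 s ∧ (card s ≡ᵇ k))) (subsets (suc (length w)))
    ≡⟨ count-subsets-suc _ (length w) ⟩
  countIdeals w true k + count (λ s → isIdeal w (false ∷ s) ∧ false) (subsets (length w))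
    ≡⟨ cong (countIdeals w true k +_) (count-∧-false (λ s → isIdeal w (false ∷ s)) (subsets (length w))) ⟩
  countIdeals w true k + 0
    ≡⟨ +-identityʳ _ ⟩
  countIdeals w true k
    ≡⟨ countIdeals≗idealPoly w true k ⟩
  idealPoly w true k
    ∎
  where open ≡-Reasoning

genCirc≗idealPoly : ∀ w → genCirc w ≗ idealPoly w false
genCirc≗idealPoly w k = begin
  genCirc w k
    ≡⟨ count-filter (isIdeal w) _ (subsets (suc (length w))) ⟩
  count (λ s → isIdeal w s ∧ (not (containsY0 s) ∧ (card s ≡ᵇ k))) (subsets (suc (length w)))
    ≡⟨ count-subsets-suc _ (length w) ⟩
  count (λ s → isIdeal w (true ∷ s) ∧ false) (subsets (length w)) + countIdeals w false k
    ≡⟨ cong (_+ countIdeals w false k) (count-∧-false (λ s → isIdeal w (true ∷ s)) (subsets (length w))) ⟩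
  countIdeals w false k
    ≡⟨ countIdeals≗idealPoly w false k ⟩
  idealPoly w false k
    ∎
  where open ≡-Reasoning

fenceVec : List Bool → Vec2
fenceVec w = vec2 (idealPoly w true) (shift (idealPoly w false))

letterMat : Bool → Mat
letterMat true  = Rq
letterMat false = Lq

e₁ : Vec2
e₁ = vec2 1ₚ 0ₚ

fenceVec-∷ : ∀ c w → fenceVec (c ∷ w) ≈ letterMat c · fenceVec w
fenceVec-∷ true w = begin
  fenceVec (true ∷ w)
    ≈⟨ shift-+ₚ (idealPoly w true) (idealPoly w false) , (λ _ → refl) ⟩
  vec2 (shift (idealPoly w true) +ₚ shift (idealPoly w false)) (shift (idealPoly w false))
    ≈⟨ Rq-· (idealPoly w true) (shift (idealPoly w false)) ⟨
  Rq · fenceVec w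
    ∎
  where open ≈-Reasoning
fenceVec-∷ false w = begin
  fenceVec (false ∷ w)
    ≈⟨ (λ _ → refl) , shift-+ₚ (idealPoly w true) (idealPoly w false) ⟩
  vec2 (shift (idealPoly w true)) (shift (idealPoly w true) +ₚ shift (idealPoly w false))
    ≈⟨ Lq-· (idealPoly w true) (shift (idealPoly w false)) ⟨
  Lq · fenceVec w
    ∎
  where open ≈-Reasoning

fenceVec-[] : fenceVec [] ≈ Lq · e₁
fenceVec-[] = begin
  fenceVec []                       ≈⟨ qₚ≗shift1ₚ , (λ _ → sym (+-identityʳ _)) ⟩
  vec2 (shift 1ₚ) (shift 1ₚ +ₚ 0ₚ)  ≈⟨ Lq-· 1ₚ 0ₚ ⟨
  Lq · e₁                           ∎
  where
  open ≈-Reasoning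
  qₚ≗shift1ₚ : qₚ ≗ shift 1ₚ
  qₚ≗shift1ₚ zero = refl
  qₚ≗shift1ₚ (suc zero) = refl
  qₚ≗shift1ₚ (suc (suc n)) = refl

fenceVec-replicate : ∀ c n w → fenceVec (replicate n c ++ w) ≈ (letterMat c ^ₘ n) · fenceVec w
fenceVec-replicate c zero w = ≈-sym (Id-· (fenceVec w))
fenceVec-replicate c (suc n) w = begin
  fenceVec (c ∷ replicate n c ++ w)               ≈⟨ fenceVec-∷ c (replicate n c ++ w) ⟩
  letterMat c · fenceVec (replicate n c ++ w)     ≈⟨ ·-congˡ (letterMat c) (fenceVec-replicate c n w) ⟩
  letterMat c · ((letterMat c ^ₘ n) · fenceVec w) ≈⟨ ⊗-· (letterMat c) (letterMat c ^ₘ n) (fenceVec w) ⟨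
  (letterMat c ^ₘ suc n) · fenceVec w             ∎
  where open ≈-Reasoning

letterBlock-· : ∀ c n M v w → M · v ≈ fenceVec w →
  ((letterMat c ^ₘ n) ⊗ M) · v ≈ fenceVec (replicate n c ++ w)
letterBlock-· c n M v w Mv≈w = begin
  ((letterMat c ^ₘ n) ⊗ M) · v    ≈⟨ ⊗-· (letterMat c ^ₘ n) M v ⟩
  (letterMat c ^ₘ n) · (M · v)    ≈⟨ ·-congˡ (letterMat c ^ₘ n) Mv≈w ⟩
  (letterMat c ^ₘ n) · fenceVec w ≈⟨ fenceVec-replicate c n w ⟨
  fenceVec (replicate n c ++ w)   ∎
  where open ≈-Reasoning

lastBlock-· : ∀ n → ((Lq ^ₘ suc n) ⊗ Id) · e₁ ≈ fenceVec (replicate n false)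
lastBlock-· n = begin
  ((Lq ^ₘ suc n) ⊗ Id) · e₁               ≈⟨ ⊗-· (Lq ^ₘ suc n) Id e₁ ⟩
  (Lq ^ₘ suc n) · (Id · e₁)             ≈⟨ ·-congˡ (Lq ^ₘ suc n) (Id-· e₁) ⟩
  (Lq ^ₘ suc n) · e₁                    ≈⟨ ^ₘ-suc-· Lq n e₁ ⟩
  (Lq ^ₘ n) · (Lq · e₁)                 ≈⟨ ·-congˡ (Lq ^ₘ n) fenceVec-[] ⟨
  (Lq ^ₘ n) · fenceVec []               ≈⟨ fenceVec-replicate false n [] ⟨
  fenceVec (replicate n false ++ [])    ≡⟨ cong fenceVec (++-identityʳ (replicate n false)) ⟩
  fenceVec (replicate n false)          ∎
  where open ≈-Reasoning

cfMat-·-e₁ : ∀ a as → EvenPos (a ∷ as) → AllPos as → cfMat (a ∷ as) · e₁ ≈ fenceVec (W (a ∷ as))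
cfMat-·-e₁ a (suc b ∷ []) (two _ _) _ = letterBlock-· true a _ e₁ _ (lastBlock-· b)
cfMat-·-e₁ a (b ∷ c ∷ as) (more _ _ even) (_ , _ , pos) =
  letterBlock-· true a _ e₁ _ (letterBlock-· false b _ e₁ _ (cfMat-·-e₁ c as even pos))

-- Only the shape of the expansion matters: x and the value equation in IsCF are never used.
theoremC : (x : ℚ) → 0ℚ < x → (a : List ℕ) → EvenPos a → IsCF a x →
    ((n : ℕ) → genBullet (W a) n ≡ Vec2.v1 (cfMat a · vec2 1ₚ 0ₚ) n)
    × ((n : ℕ) → genCirc (W a) n ≡ Vec2.v2 (cfMat a · vec2 1ₚ 0ₚ) (suc n))
    × (Vec2.v2 (cfMat a · vec2 1ₚ 0ₚ) 0 ≡ 0)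
theoremC _ _ (a ∷ as) even (pos , _) =
    (λ n → trans (genBullet≗idealPoly (W (a ∷ as)) n) (sym (proj₁ matrix≈fence n)))
  , (λ n → trans (genCirc≗idealPoly (W (a ∷ as)) n) (sym (proj₂ matrix≈fence (suc n))))
  , proj₂ matrix≈fence 0
  where
  matrix≈fence : cfMat (a ∷ as) · e₁ ≈ fenceVec (W (a ∷ as))
  matrix≈fence = cfMat-·-e₁ a as even pos
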